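{- Let $1\le k<n$. Then $\mathbb{Y}_{OG(k,2n+1)}\subseteq\Theta(k,2n+1)$.
   Context: Type $B_n$ positive roots in $\mathbb{R}^n$: $e_a\pm e_b$ ($a<b$), $e_a$; simple roots $e_i-e_{i+1}$ ($i<n$), $e_n$; $\alpha\preceq\alpha'$ iff $\alpha'-\alpha$ is a nonnegative combination of simple roots. $\Lambda_k$ consists of the base region $\{e_a\pm e_c, e_a: a\le k<c\}$ and the top region $\{e_a+e_b:a<b\le k\}$. For $1\le a\le k$, row$(a)$ is $\{e_a\pm e_c:c>k\}\cup\{e_a\}$. $\Theta(k,2n+1)$ is the set of $S\subseteq\Lambda_k$ such that $S$ meets each of the base and top regions in a lower order ideal of that region, and for every $e_a+e_b$ with $a<b\le k$: if $|S\cap\text{row}(a)|+|S\cap\text{row}(b)|>2n+1-2k$ then $e_a+e_b\in S$, and if this sum is $<2n+1-2k$ then $e_a+e_b\notin S$. $W^{OG(k,2n+1)}$: signed permutations $(y_1,\dots,y_{k-r},\overline{z_r},\dots,\overline{z_1},v_1,\dots,v_{n-k})$, $0\le r\le k$, $\{y\}\cup\{z\}\cup\{v\}=\{1,\dots,n\}$, $y$'s increasing, $z_r>\dots>z_1$, $v$'s increasing, bars denoting negative entries. $w(e_a)=e_m$ if the $a$-th entry is $m$, $-e_m$ if it is $\overline m$. $\lambda(w)=\{\alpha>0:w(\alpha)<0\}$ and $\mathbb{Y}_{OG(k,2n+1)}=\{\lambda(w):w\in W^{OG(k,2n+1)}\}$. -}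

module Defs where

open import Data.Bool using (Bool; true; false; if_then_else_; _∧_)
open import Data.Nat as ℕ using (ℕ; _≤_; _<_; _∸_; _≡ᵇ_)
open import Data.Fin as Fin using (Fin; toℕ)
open import Data.Integer as ℤ using (ℤ; +_; -[1+_]; 0ℤ; 1ℤ; -1ℤ; ∣_∣)
open import Data.Vec using (Vec; tabulate; zipWith; map; replicate; lookup)
open import Data.Vec.Properties using (≡-dec)
open import Data.List as List using (List; _++_; []; _∷_; allFin; filterᵇ; length; concatMap)
open import Data.List.Relation.Unary.Any using (any?)
open import Data.Product using (Σ; ∃; ∃-syntax; _×_; _,_)
open import Data.Sum using (_⊎_)
open import Relation.Nullary.Decidable using (does)
open import Relation.Binary.PropositionalEquality using (_≡_)

-- Vectors in ℤ^n.  Coordinates are indexed by Fin n; the paper's index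
-- a ∈ {1,…,n} corresponds to the Fin n element with toℕ = a - 1.

Vect : ℕ → Set
Vect n = Vec ℤ n

_⊕_ : ∀ {n} → Vect n → Vect n → Vect n
_⊕_ = zipWith ℤ._+_

_⊖_ : ∀ {n} → Vect n → Vect n → Vect n
_⊖_ = zipWith ℤ._-_

neg : ∀ {n} → Vect n → Vect n
neg = map (λ x → ℤ.- x)

scale : ∀ {n} → ℤ → Vect n → Vect n
scale c = map (c ℤ.*_)

zeroV : ∀ {n} → Vect n
zeroV = replicate _ 0ℤ

e : ∀ {n} → Fin n → Vect n
e a = tabulate (λ j → if does (j Fin.≟ a) then 1ℤ else 0ℤ)

sumV : ∀ {n m} → (Fin m → Vect n) → Vect n
sumV f = List.foldr (λ i acc → f i ⊕ acc) zeroV (allFin _)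

posRoots : (n : ℕ) → List (Vect n)
posRoots n =
  concatMap (λ a → concatMap (λ b →
      if does (toℕ a ℕ.<? toℕ b) then (e a ⊖ e b) ∷ (e a ⊕ e b) ∷ [] else [])
    (allFin n)) (allFin n)
  ++ List.map e (allFin n)

isPosRoot : ∀ {n} → Vect n → Bool
isPosRoot {n} v = does (any? (λ u → ≡-dec ℤ._≟_ v u) (posRoots n))

-- simple roots: e_i - e_{i+1} for i < n (paper indexing), and e_n.
-- (For the last index i the "-1" entry at position i+1 does not exist,
--  so the formula below yields exactly e_n.)
simple : ∀ {n} → Fin n → Vect n
simple i = tabulate (λ j →
  if toℕ j ℕ.≡ᵇ toℕ i then 1ℤ
  else if toℕ j ℕ.≡ᵇ ℕ.suc (toℕ i) then -1ℤ else 0ℤ)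

_⪯_ : ∀ {n} → Vect n → Vect n → Set
_⪯_ {n} α β = Σ (Fin n → ℕ) λ c → (β ⊖ α) ≡ sumV {n} {n} (λ i → scale (+ c i) (simple i))

-- Λ_k, its base and top regions, rows.  (k is the paper's k; an index a
-- with toℕ a < k is a paper index ≤ k.)

BaseRegion : ∀ {n} → ℕ → Vect n → Set
BaseRegion {n} k α =
    (∃[ a ] ∃[ c ] (toℕ a < k × k ≤ toℕ c × (α ≡ e a ⊖ e c ⊎ α ≡ e a ⊕ e c)))
  ⊎ (∃[ a ] (toℕ a < k × α ≡ e a))

TopRegion : ∀ {n} → ℕ → Vect n → Set
TopRegion {n} k α = ∃[ a ] ∃[ b ] (toℕ a < toℕ b × toℕ b < k × α ≡ e a ⊕ e b)

Lambda : ∀ {n} → ℕ → Vect n → Set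
Lambda k α = BaseRegion k α ⊎ TopRegion k α

-- row(a) = {e_a ± e_c : c > k} ∪ {e_a}, as an explicit duplicate-free list
row : ∀ {n} → ℕ → Fin n → List (Vect n)
row {n} k a =
  concatMap (λ c → if does (k ℕ.≤? toℕ c) then (e a ⊖ e c) ∷ (e a ⊕ e c) ∷ [] else [])
    (allFin n)
  ++ e a ∷ []

Subset : ℕ → Set
Subset n = Vect n → Bool

rowCount : ∀ {n} → ℕ → Subset n → Fin n → ℕ
rowCount k S a = length (filterᵇ S (row k a))

LowerIdealIn : ∀ {n} → (Vect n → Set) → Subset n → Set
LowerIdealIn {n} R S =
  ∀ (α β : Vect n) → R α → R β → S β ≡ true → α ⪯ β → S α ≡ true

InTheta : (n k : ℕ) → Subset n → Set
InTheta n k S =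
    (∀ α → S α ≡ true → Lambda k α)
  × LowerIdealIn (BaseRegion k) S
  × LowerIdealIn (TopRegion k) S
  × (∀ (a b : Fin n) → toℕ a < toℕ b → toℕ b < k →
       ((2 ℕ.* n ℕ.+ 1) ∸ 2 ℕ.* k < rowCount k S a ℕ.+ rowCount k S b → S (e a ⊕ e b) ≡ true)
     × (rowCount k S a ℕ.+ rowCount k S b < (2 ℕ.* n ℕ.+ 1) ∸ 2 ℕ.* k → S (e a ⊕ e b) ≡ false))

-- Signed permutations, written in one-line notation as a vector of
-- nonzero integers (a negative entry -m is the paper's  \overline m).

SignedPerm : (n : ℕ) → Vec ℤ n → Set
SignedPerm n w =
    (∀ i → 1 ≤ ∣ lookup w i ∣ × ∣ lookup w i ∣ ≤ n)
  × (∀ i j → ∣ lookup w i ∣ ≡ ∣ lookup w j ∣ → i ≡ j)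

-- W^{OG(k,2n+1)}: (y_1,…,y_{k-r}, \bar z_r,…,\bar z_1, v_1,…,v_{n-k})
-- with y's increasing, z_r > … > z_1, v's increasing.
InWOG : (n k : ℕ) → Vec ℤ n → Set
InWOG n k w = SignedPerm n w × ∃[ r ] (r ≤ k
  × (∀ i → (toℕ i < k ∸ r → 0ℤ ℤ.< lookup w i)
         × (k ∸ r ≤ toℕ i → toℕ i < k → lookup w i ℤ.< 0ℤ)
         × (k ≤ toℕ i → 0ℤ ℤ.< lookup w i))
  × (∀ i j → toℕ i < toℕ j →
           (toℕ j < k ∸ r → lookup w i ℤ.< lookup w j)
         × (k ∸ r ≤ toℕ i → toℕ j < k → ∣ lookup w j ∣ < ∣ lookup w i ∣)
         × (k ≤ toℕ i → lookup w i ℤ.< lookup w j)))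

sgn : ℤ → ℤ
sgn (+ _)    = 1ℤ
sgn -[1+ _ ] = -1ℤ

-- w(e_a) = ± e_m  where the a-th entry is ±m
signedBasis : ∀ {n} → ℤ → Vect n
signedBasis x = tabulate (λ m → if ℕ.suc (toℕ m) ℕ.≡ᵇ ∣ x ∣ then sgn x else 0ℤ)

act : ∀ {n} → Vec ℤ n → Vect n → Vect n
act {n} w α = sumV {n} {n} (λ a → scale (lookup α a) (signedBasis (lookup w a)))

lam : ∀ {n} → Vec ℤ n → Subset n
lam w α = isPosRoot α ∧ isPosRoot (neg (act w α))

-- Everything about roots is read off the partial-sum functionals v ↦ v₀ + … + vⱼ.
-- Positive roots, simple roots included, have nonnegative partial sums, so α ⪯ β
-- raises every partial sum, and ±e_p ± e_q is positive exactly when its sign at the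
-- smaller position is +.  As w(e_a) = ±e_{|w_a|}, this gives formulas for the
-- membership of e_a and e_a ± e_b in λ(w) in terms of the signs of w_a, w_b and the
-- comparison of |w_a| and |w_b| (module Inversions).  For w ∈ W^{OG} the positions
-- form blocks Y, Z, V on which these data are known, giving a membership table
-- (module Grassmannian).  From it: λ(w) ⊆ Λ_k; the lower-ideal properties, using
-- the partial-sum constraints on ⪯ inside the base and top regions; and the row-count
-- condition, counting row(a) column by column.

module Submission where

open import Defs
open import Data.Nat using (ℕ; _≤_; _<_)
open import Data.Integer using (ℤ)
open import Data.Vec using (Vec; lookup)

open import Function using (_∘_; id)
open import Data.Bool using (Bool; true; false; if_then_else_; not; T)
open import Data.Empty using (⊥-elim)
open import Data.Product using (Σ; ∃-syntax; _×_; _,_; proj₁; proj₂)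
open import Data.Sum using (_⊎_; inj₁; inj₂)
import Data.Nat as N
import Data.Nat.Properties as NP
import Data.Integer as Z
open Z using (+_; -[1+_]; 0ℤ; 1ℤ; -1ℤ; ∣_∣; _+_; _*_; -_; _-_)
import Data.Integer.Properties as ZP
open import Data.Integer.Tactic.RingSolver using (solve-∀)
open import Data.Fin as F using (Fin; toℕ; zero; suc)
import Data.Fin.Properties as FP
import Data.Vec.Properties as VP
open import Data.Vec.Relation.Binary.Pointwise.Extensional using (ext; Pointwise-≡⇒≡)
import Data.List as L
open L using (List; []; _∷_; _++_)
import Data.List.Properties as LP
open import Data.List.Membership.Propositional using (_∈_; lose)
open import Data.List.Membership.Propositional.Properties
  using (∈-++⁻; ∈-++⁺ˡ; ∈-++⁺ʳ; ∈-concatMap⁺; ∈-concatMap⁻; ∈-map⁺; ∈-map⁻; ∈-allFin)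
open import Data.List.Relation.Unary.Any using (here; there; satisfied; any?)
open import Relation.Nullary using (¬_; Dec; yes; no; does)
open import Relation.Nullary.Decidable using (dec-true; dec-false; T?)
open import Relation.Binary using (tri<; tri≈; tri>)
open import Relation.Binary.PropositionalEquality
open import Algebra.Properties.CommutativeSemigroup NP.+-commutativeSemigroup using (interchange)
open import Algebra.Properties.Semiring.Sum ZP.+-*-semiring
  using (sum; sum-cong-≗; ∑-distrib-+; ∑-comm; *-distribˡ-sum; sum-remove; sum-replicate-zero)
import Algebra.Properties.Semiring.Sum NP.+-*-semiring as Σℕ

vec-ext : ∀ {n} {u v : Vect n} → (∀ m → lookup u m ≡ lookup v m) → u ≡ v
vec-ext h = Pointwise-≡⇒≡ (ext h)

coord-⊕ : ∀ {n} (u v : Vect n) m → lookup (u ⊕ v) m ≡ lookup u m + lookup v m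
coord-⊕ u v m = VP.lookup-zipWith Z._+_ m u v

coord-⊖ : ∀ {n} (u v : Vect n) m → lookup (u ⊖ v) m ≡ lookup u m - lookup v m
coord-⊖ u v m = VP.lookup-zipWith Z._-_ m u v

coord-neg : ∀ {n} (u : Vect n) m → lookup (neg u) m ≡ - lookup u m
coord-neg u m = VP.lookup-map m _ u

coord-scale : ∀ {n} c (u : Vect n) m → lookup (scale c u) m ≡ c * lookup u m
coord-scale c u m = VP.lookup-map m _ u

coord-e : ∀ {n} (a j : Fin n) → lookup (e a) j ≡ (if does (j F.≟ a) then 1ℤ else 0ℤ)
coord-e a j = VP.lookup∘tabulate _ j

coord-e-same : ∀ {n} (a : Fin n) → lookup (e a) a ≡ 1ℤ
coord-e-same a rewrite coord-e a a | dec-true (a F.≟ a) refl = refl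

coord-e-other : ∀ {n} (a j : Fin n) → j ≢ a → lookup (e a) j ≡ 0ℤ
coord-e-other a j j≢a rewrite coord-e a j | dec-false (j F.≟ a) j≢a = refl

⊕-comm : ∀ {n} (u v : Vect n) → u ⊕ v ≡ v ⊕ u
⊕-comm u v = vec-ext λ m → begin
  lookup (u ⊕ v) m          ≡⟨ coord-⊕ u v m ⟩
  lookup u m + lookup v m   ≡⟨ ZP.+-comm (lookup u m) (lookup v m) ⟩
  lookup v m + lookup u m   ≡⟨ coord-⊕ v u m ⟨
  lookup (v ⊕ u) m          ∎
  where open ≡-Reasoning

⊖≡⊕neg : ∀ {n} (u v : Vect n) → u ⊖ v ≡ u ⊕ neg v
⊖≡⊕neg u v = vec-ext λ m → begin
  lookup (u ⊖ v) m            ≡⟨ coord-⊖ u v m ⟩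
  lookup u m - lookup v m     ≡⟨ cong (_+_ (lookup u m)) (coord-neg v m) ⟨
  lookup u m + lookup (neg v) m ≡⟨ coord-⊕ u (neg v) m ⟨
  lookup (u ⊕ neg v) m        ∎
  where open ≡-Reasoning

neg-⊕ : ∀ {n} (u v : Vect n) → neg (u ⊕ v) ≡ neg u ⊕ neg v
neg-⊕ u v = vec-ext λ m → begin
  lookup (neg (u ⊕ v)) m              ≡⟨ coord-neg (u ⊕ v) m ⟩
  - lookup (u ⊕ v) m                  ≡⟨ cong -_ (coord-⊕ u v m) ⟩
  - (lookup u m + lookup v m)         ≡⟨ ZP.neg-distrib-+ (lookup u m) (lookup v m) ⟩
  - lookup u m + - lookup v m         ≡⟨ cong₂ _+_ (coord-neg u m) (coord-neg v m) ⟨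
  lookup (neg u) m + lookup (neg v) m ≡⟨ coord-⊕ (neg u) (neg v) m ⟨
  lookup (neg u ⊕ neg v) m            ∎
  where open ≡-Reasoning

neg-neg : ∀ {n} (u : Vect n) → neg (neg u) ≡ u
neg-neg u = vec-ext λ m →
  trans (coord-neg (neg u) m) (trans (cong -_ (coord-neg u m)) (ZP.neg-involutive _))

neg-⊖ : ∀ {n} (u v : Vect n) → neg (u ⊖ v) ≡ neg u ⊕ v
neg-⊖ u v = begin
  neg (u ⊖ v)             ≡⟨ cong neg (⊖≡⊕neg u v) ⟩
  neg (u ⊕ neg v)         ≡⟨ neg-⊕ u (neg v) ⟩
  neg u ⊕ neg (neg v)     ≡⟨ cong (neg u ⊕_) (neg-neg v) ⟩
  neg u ⊕ v               ∎
  where open ≡-Reasoning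

sum-single : ∀ {n} (f : Fin n → ℤ) (a : Fin n) → (∀ j → j ≢ a → f j ≡ 0ℤ) → sum f ≡ f a
sum-single {N.suc n} f a others = begin
  sum f                         ≡⟨ sum-remove {i = a} f ⟩
  f a + sum (f ∘ F.punchIn a)   ≡⟨ cong (_+_ (f a)) rest≡0 ⟩
  f a + 0ℤ                      ≡⟨ ZP.+-identityʳ (f a) ⟩
  f a                           ∎
  where
  open ≡-Reasoning
  rest≡0 : sum (f ∘ F.punchIn a) ≡ 0ℤ
  rest≡0 = trans (sum-cong-≗ (λ j → others _ (FP.punchInᵢ≢i a j))) (sum-replicate-zero n)

sum-neg : ∀ {n} (f : Fin n → ℤ) → sum (λ i → - f i) ≡ - sum f
sum-neg {N.zero} f = refl
sum-neg {N.suc n} f = trans (cong (_+_ (- f zero)) (sum-neg (f ∘ suc)))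
                            (sym (ZP.neg-distrib-+ (f zero) (sum (f ∘ suc))))

sum-nonneg : ∀ {n} (f : Fin n → ℤ) → (∀ i → 0ℤ Z.≤ f i) → 0ℤ Z.≤ sum f
sum-nonneg {N.zero} f _ = Z.+≤+ N.z≤n
sum-nonneg {N.suc n} f f≥0 = ZP.+-mono-≤ (f≥0 zero) (sum-nonneg (f ∘ suc) (f≥0 ∘ suc))

coord-sumV : ∀ {n m} (f : Fin m → Vect n) j → lookup (sumV {n} {m} f) j ≡ sum (λ i → lookup (f i) j)
coord-sumV {n} {m} f j = fold id
  where
  fold : ∀ {k} (g : Fin k → Fin m) →
    lookup (L.foldr (λ i acc → f i ⊕ acc) zeroV (L.tabulate g)) j ≡ sum (λ i → lookup (f (g i)) j)
  fold {N.zero} g = VP.lookup-replicate j 0ℤ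
  fold {N.suc k} g = trans (coord-⊕ (f (g zero)) _ j) (cong (_+_ (lookup (f (g zero)) j)) (fold (g ∘ suc)))

module Action {n} (w : Vec ℤ n) where

  image : Fin n → Vect n
  image a = signedBasis (lookup w a)

  coord-act : ∀ α m → lookup (act w α) m ≡ sum (λ a → lookup α a * lookup (image a) m)
  coord-act α m = trans (coord-sumV (λ a → scale (lookup α a) (image a)) m)
                        (sum-cong-≗ (λ a → coord-scale (lookup α a) (image a) m))

  act-e : ∀ a → act w (e a) ≡ image a
  act-e a = vec-ext λ m → begin
    lookup (act w (e a)) m                            ≡⟨ coord-act (e a) m ⟩
    sum (λ b → lookup (e a) b * lookup (image b) m)    ≡⟨ sum-single _ a (λ b b≢a → cong (_* lookup (image b) m) (coord-e-other a b b≢a)) ⟩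
    lookup (e a) a * lookup (image a) m                ≡⟨ cong (_* lookup (image a) m) (coord-e-same a) ⟩
    1ℤ * lookup (image a) m                            ≡⟨ ZP.*-identityˡ _ ⟩
    lookup (image a) m                                 ∎
    where open ≡-Reasoning

  act-⊕ : ∀ u v → act w (u ⊕ v) ≡ act w u ⊕ act w v
  act-⊕ u v = vec-ext λ m → begin
    lookup (act w (u ⊕ v)) m                                ≡⟨ coord-act (u ⊕ v) m ⟩
    sum (λ a → lookup (u ⊕ v) a * x a m)                    ≡⟨ sum-cong-≗ (λ a → distrib a m) ⟩
    sum (λ a → lookup u a * x a m + lookup v a * x a m)     ≡⟨ ∑-distrib-+ (λ a → lookup u a * x a m) (λ a → lookup v a * x a m) ⟩
    sum (λ a → lookup u a * x a m) + sum (λ a → lookup v a * x a m)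
                                                            ≡⟨ cong₂ _+_ (coord-act u m) (coord-act v m) ⟨
    lookup (act w u) m + lookup (act w v) m                 ≡⟨ coord-⊕ (act w u) (act w v) m ⟨
    lookup (act w u ⊕ act w v) m                            ∎
    where
    open ≡-Reasoning
    x : Fin n → Fin n → ℤ
    x a m = lookup (image a) m
    distrib : ∀ a m → lookup (u ⊕ v) a * x a m ≡ lookup u a * x a m + lookup v a * x a m
    distrib a m = trans (cong (_* x a m) (coord-⊕ u v a)) (ZP.*-distribʳ-+ (x a m) (lookup u a) (lookup v a))

  act-neg : ∀ u → act w (neg u) ≡ neg (act w u)
  act-neg u = vec-ext λ m → begin
    lookup (act w (neg u)) m                      ≡⟨ coord-act (neg u) m ⟩
    sum (λ a → lookup (neg u) a * x a m)          ≡⟨ sum-cong-≗ (λ a → negate a m) ⟩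
    sum (λ a → - (lookup u a * x a m))            ≡⟨ sum-neg (λ a → lookup u a * x a m) ⟩
    - sum (λ a → lookup u a * x a m)              ≡⟨ cong -_ (coord-act u m) ⟨
    - lookup (act w u) m                          ≡⟨ coord-neg (act w u) m ⟨
    lookup (neg (act w u)) m                      ∎
    where
    open ≡-Reasoning
    x : Fin n → Fin n → ℤ
    x a m = lookup (image a) m
    negate : ∀ a m → lookup (neg u) a * x a m ≡ - (lookup u a * x a m)
    negate a m = trans (cong (_* x a m) (coord-neg u a)) (sym (ZP.neg-distribˡ-* (lookup u a) (x a m)))

  act-⊖ : ∀ u v → act w (u ⊖ v) ≡ act w u ⊖ act w v
  act-⊖ u v = begin
    act w (u ⊖ v)               ≡⟨ cong (act w) (⊖≡⊕neg u v) ⟩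
    act w (u ⊕ neg v)           ≡⟨ act-⊕ u (neg v) ⟩
    act w u ⊕ act w (neg v)     ≡⟨ cong (act w u ⊕_) (act-neg v) ⟩
    act w u ⊕ neg (act w v)     ≡⟨ ⊖≡⊕neg (act w u) (act w v) ⟨
    act w u ⊖ act w v           ∎
    where open ≡-Reasoning

weighted : ∀ {n} → (Fin n → ℤ) → Vect n → ℤ
weighted c v = sum (λ i → c i * lookup v i)

module _ {n} (c : Fin n → ℤ) where

  weighted-e : ∀ a → weighted c (e a) ≡ c a
  weighted-e a = trans (sum-single _ a (λ i i≢a → trans (cong (c i *_) (coord-e-other a i i≢a)) (ZP.*-zeroʳ (c i))))
                       (trans (cong (c a *_) (coord-e-same a)) (ZP.*-identityʳ (c a)))

  weighted-⊕ : ∀ u v → weighted c (u ⊕ v) ≡ weighted c u + weighted c v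
  weighted-⊕ u v = trans (sum-cong-≗ λ i → trans (cong (c i *_) (coord-⊕ u v i)) (ZP.*-distribˡ-+ (c i) _ _))
                         (∑-distrib-+ (λ i → c i * lookup u i) (λ i → c i * lookup v i))

  weighted-neg : ∀ u → weighted c (neg u) ≡ - weighted c u
  weighted-neg u = trans (sum-cong-≗ λ i → trans (cong (c i *_) (coord-neg u i)) (sym (ZP.neg-distribʳ-* (c i) _)))
                         (sum-neg (λ i → c i * lookup u i))

  weighted-⊖ : ∀ u v → weighted c (u ⊖ v) ≡ weighted c u - weighted c v
  weighted-⊖ u v = trans (cong (weighted c) (⊖≡⊕neg u v))
                         (trans (weighted-⊕ u (neg v)) (cong (_+_ (weighted c u)) (weighted-neg v)))

  weighted-scale : ∀ d u → weighted c (scale d u) ≡ d * weighted c u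
  weighted-scale d u = trans (sum-cong-≗ λ i → trans (cong (c i *_) (coord-scale d u i)) (swap (c i) d (lookup u i)))
                             (sym (*-distribˡ-sum d (λ i → c i * lookup u i)))
    where
    swap : ∀ x y z → x * (y * z) ≡ y * (x * z)
    swap = solve-∀

  weighted-sumV : ∀ {m} (f : Fin m → Vect n) → weighted c (sumV {n} {m} f) ≡ sum (λ a → weighted c (f a))
  weighted-sumV f = begin
    sum (λ i → c i * lookup (sumV f) i)             ≡⟨ sum-cong-≗ (λ i → cong (c i *_) (coord-sumV f i)) ⟩
    sum (λ i → c i * sum (λ a → lookup (f a) i))     ≡⟨ sum-cong-≗ (λ i → *-distribˡ-sum (c i) (λ a → lookup (f a) i)) ⟩
    sum (λ i → sum (λ a → c i * lookup (f a) i))     ≡⟨ ∑-comm (λ i a → c i * lookup (f a) i) ⟩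
    sum (λ a → weighted c (f a))                     ∎
    where open ≡-Reasoning

ι : Bool → ℤ
ι true = 1ℤ
ι false = 0ℤ

ι-nonneg : ∀ b → 0ℤ Z.≤ ι b
ι-nonneg true = Z.+≤+ N.z≤n
ι-nonneg false = Z.+≤+ N.z≤n

-- The partial sums  v₀ + v₁ + … + vⱼ  (0-based coordinates).  Positive roots
-- have nonnegative partial sums, so these functionals are monotone for ⪯; they
-- are the only information about ⪯ the proof needs.
upTo : ∀ {n} → ℕ → Fin n → ℤ
upTo j i = ι (does (toℕ i N.≤? j))

partial : ∀ {n} → ℕ → Vect n → ℤ
partial j = weighted (upTo j)

partial-e : ∀ {n} j (a : Fin n) → partial j (e a) ≡ ι (does (toℕ a N.≤? j))
partial-e j = weighted-e (upTo j)

partial-e-in : ∀ {n} j (a : Fin n) → toℕ a ≤ j → partial j (e a) ≡ 1ℤ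
partial-e-in j a a≤j = trans (partial-e j a) (cong ι (dec-true (toℕ a N.≤? j) a≤j))

partial-e-out : ∀ {n} j (a : Fin n) → j < toℕ a → partial j (e a) ≡ 0ℤ
partial-e-out j a j<a = trans (partial-e j a) (cong ι (dec-false (toℕ a N.≤? j) (NP.<⇒≱ j<a)))

partial-⊕ : ∀ {n} j (u v : Vect n) → partial j (u ⊕ v) ≡ partial j u + partial j v
partial-⊕ j = weighted-⊕ (upTo j)

partial-⊖ : ∀ {n} j (u v : Vect n) → partial j (u ⊖ v) ≡ partial j u - partial j v
partial-⊖ j = weighted-⊖ (upTo j)

partial-neg : ∀ {n} j (u : Vect n) → partial j (neg u) ≡ - partial j u
partial-neg j = weighted-neg (upTo j)

PositiveRoot : ∀ {n} → Vect n → Set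
PositiveRoot {n} v = (∃[ a ] ∃[ b ] (toℕ a < toℕ b × (v ≡ e a ⊖ e b ⊎ v ≡ e a ⊕ e b)))
                   ⊎ (∃[ a ] (v ≡ e a))

partial-positive : ∀ {n} {v : Vect n} → PositiveRoot v → ∀ j → 0ℤ Z.≤ partial j v
partial-positive (inj₂ (a , refl)) j rewrite partial-e j a = ι-nonneg _
partial-positive (inj₁ (a , b , a<b , inj₂ refl)) j rewrite partial-⊕ j (e a) (e b) | partial-e j a | partial-e j b =
  ZP.+-mono-≤ (ι-nonneg (does (toℕ a N.≤? j))) (ι-nonneg (does (toℕ b N.≤? j)))
partial-positive (inj₁ (a , b , a<b , inj₁ refl)) j rewrite partial-⊖ j (e a) (e b) with toℕ b N.≤? j
... | yes b≤j rewrite partial-e-in j b b≤j | partial-e-in j a (NP.≤-trans (NP.<⇒≤ a<b) b≤j) = Z.+≤+ N.z≤n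
... | no b≰j rewrite partial-e-out j b (NP.≰⇒> b≰j) | ZP.+-identityʳ (partial j (e a)) | partial-e j a = ι-nonneg _

∈-if : ∀ {A P : Set} (d : Dec P) {xs : List A} {v : A} → v ∈ (if does d then xs else []) → P × v ∈ xs
∈-if (yes p) v∈ = p , v∈

if-∋ : ∀ {A P : Set} (d : Dec P) {xs : List A} {v : A} → P → v ∈ xs → v ∈ (if does d then xs else [])
if-∋ (yes _) _ v∈ = v∈
if-∋ (no ¬p) p _ = ⊥-elim (¬p p)

module _ {n : ℕ} where

  pairsAt : Fin n → Fin n → List (Vect n)
  pairsAt a b = if does (toℕ a N.<? toℕ b) then (e a ⊖ e b) ∷ (e a ⊕ e b) ∷ [] else []

  ∈-pairsAt : ∀ {v} a b → v ∈ pairsAt a b → toℕ a < toℕ b × (v ≡ e a ⊖ e b ⊎ v ≡ e a ⊕ e b)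
  ∈-pairsAt a b v∈ with ∈-if (toℕ a N.<? toℕ b) v∈
  ... | a<b , here v≡         = a<b , inj₁ v≡
  ... | a<b , there (here v≡) = a<b , inj₂ v≡

  pairsAt-∋ : ∀ {v} a b → toℕ a < toℕ b → (v ≡ e a ⊖ e b ⊎ v ≡ e a ⊕ e b) → v ∈ pairsAt a b
  pairsAt-∋ a b a<b (inj₁ v≡) = if-∋ (toℕ a N.<? toℕ b) a<b (here v≡)
  pairsAt-∋ a b a<b (inj₂ v≡) = if-∋ (toℕ a N.<? toℕ b) a<b (there (here v≡))

  pairRoots : List (Vect n)
  pairRoots = L.concatMap (λ a → L.concatMap (pairsAt a) (L.allFin n)) (L.allFin n)

  posRoots-sound : ∀ {v} → v ∈ posRoots n → PositiveRoot v
  posRoots-sound v∈ with ∈-++⁻ pairRoots v∈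
  ... | inj₂ v∈basis with ∈-map⁻ e v∈basis
  ...   | a , _ , v≡ = inj₂ (a , v≡)
  posRoots-sound v∈ | inj₁ v∈pairs with satisfied (∈-concatMap⁻ (λ a → L.concatMap (pairsAt a) (L.allFin n)) {xs = L.allFin n} v∈pairs)
  ... | a , v∈a with satisfied (∈-concatMap⁻ (pairsAt a) {xs = L.allFin n} v∈a)
  ...   | b , v∈ab = inj₁ (a , b , ∈-pairsAt a b v∈ab)

  posRoots-complete : ∀ {v} → PositiveRoot v → v ∈ posRoots n
  posRoots-complete (inj₂ (a , refl)) = ∈-++⁺ʳ pairRoots (∈-map⁺ e (∈-allFin a))
  posRoots-complete (inj₁ (a , b , a<b , v≡)) = ∈-++⁺ˡ (∈-concatMap⁺ (λ a → L.concatMap (pairsAt a) (L.allFin n)) (lose (∈-allFin a)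
    (∈-concatMap⁺ (pairsAt a) (lose (∈-allFin b) (pairsAt-∋ a b a<b v≡)))))

isPosRoot-true : ∀ {n} {v : Vect n} → PositiveRoot v → isPosRoot v ≡ true
isPosRoot-true {n} {v} pr = dec-true (any? (λ u → VP.≡-dec Z._≟_ v u) (posRoots n)) (posRoots-complete pr)

isPosRoot-sound : ∀ {n} {v : Vect n} → isPosRoot v ≡ true → PositiveRoot v
isPosRoot-sound {n} {v} isPos with any? (λ u → VP.≡-dec Z._≟_ v u) (posRoots n)
... | yes v∈ = posRoots-sound v∈

isPosRoot-false : ∀ {n} (v : Vect n) j → partial j v Z.< 0ℤ → isPosRoot v ≡ false
isPosRoot-false v j neg-sum with isPosRoot v in isPos
... | false = refl
... | true = ⊥-elim (ZP.≤⇒≯ (partial-positive (isPosRoot-sound {v = v} isPos) j) neg-sum)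

≡ᵇ-toℕ : ∀ {n} (m p : Fin n) → (toℕ m N.≡ᵇ toℕ p) ≡ does (m F.≟ p)
≡ᵇ-toℕ zero zero = refl
≡ᵇ-toℕ zero (suc p) = refl
≡ᵇ-toℕ (suc m) zero = refl
≡ᵇ-toℕ (suc m) (suc p) = ≡ᵇ-toℕ m p

simple-positive : ∀ {n} (i : Fin n) → PositiveRoot (simple i)
simple-positive {n} i with N.suc (toℕ i) N.<? n
... | yes i+1<n = inj₁ (i , i+1 , i<i+1 , inj₁ (vec-ext coords))
  where
  i+1 = F.fromℕ< i+1<n
  i<i+1 : toℕ i < toℕ i+1
  i<i+1 = NP.≤-reflexive (sym (FP.toℕ-fromℕ< i+1<n))
  at-i+1 : ∀ m → (toℕ m N.≡ᵇ N.suc (toℕ i)) ≡ does (m F.≟ i+1)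
  at-i+1 m = trans (cong (toℕ m N.≡ᵇ_) (sym (FP.toℕ-fromℕ< i+1<n))) (≡ᵇ-toℕ m i+1)
  coords : ∀ m → lookup (simple i) m ≡ lookup (e i ⊖ e i+1) m
  coords m rewrite VP.lookup∘tabulate (λ j → if toℕ j N.≡ᵇ toℕ i then 1ℤ
                                            else if toℕ j N.≡ᵇ N.suc (toℕ i) then -1ℤ else 0ℤ) m
                 | ≡ᵇ-toℕ m i | at-i+1 m
                 | coord-⊖ (e i) (e i+1) m | coord-e i m | coord-e i+1 m
                 with m F.≟ i | m F.≟ i+1
  ... | yes refl | yes m≡i+1 = ⊥-elim (NP.<-irrefl (cong toℕ m≡i+1) i<i+1)
  ... | yes _    | no _      = refl
  ... | no _     | yes _     = refl
  ... | no _     | no _      = refl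
... | no i+1≮n = inj₂ (i , vec-ext coords)
  where
  coords : ∀ m → lookup (simple i) m ≡ lookup (e i) m
  coords m rewrite VP.lookup∘tabulate (λ j → if toℕ j N.≡ᵇ toℕ i then 1ℤ
                                            else if toℕ j N.≡ᵇ N.suc (toℕ i) then -1ℤ else 0ℤ) m
                 | ≡ᵇ-toℕ m i | coord-e i m
                 | dec-false (toℕ m N.≟ N.suc (toℕ i)) (λ m≡i+1 → i+1≮n (subst (_< n) m≡i+1 (FP.toℕ<n m)))
                 with m F.≟ i
  ... | yes _ = refl
  ... | no _  = refl

-- α ⪯ β makes every partial sum of β at least that of α, since β - α is a
-- nonnegative combination of simple roots, whose partial sums are nonnegative.
⪯-partial : ∀ {n} {α β : Vect n} → α ⪯ β → ∀ j → partial j α Z.≤ partial j β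
⪯-partial {n} {α} {β} (c , β-α≡) j = ZP.0≤i-j⇒j≤i (subst (0ℤ Z.≤_) difference (sum-nonneg _ term-nonneg))
  where
  open ≡-Reasoning
  term : Fin n → Vect n
  term i = scale (+ c i) (simple i)
  term-nonneg : ∀ i → 0ℤ Z.≤ + c i * partial j (simple i)
  term-nonneg i = subst (Z._≤ + c i * partial j (simple i)) (ZP.*-zeroʳ (+ c i))
                        (ZP.*-monoˡ-≤-nonNeg (+ c i) (partial-positive (simple-positive i) j))
  difference : sum (λ i → + c i * partial j (simple i)) ≡ partial j β - partial j α
  difference = begin
    sum (λ i → + c i * partial j (simple i))  ≡⟨ sum-cong-≗ (λ i → weighted-scale (upTo j) (+ c i) (simple i)) ⟨
    sum (λ i → partial j (term i))            ≡⟨ weighted-sumV (upTo j) term ⟨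
    partial j (sumV {n} {n} term)             ≡⟨ cong (partial j) β-α≡ ⟨
    partial j (β ⊖ α)                         ≡⟨ partial-⊖ j β α ⟩
    partial j β - partial j α                 ∎

<ᵇ-true : ∀ {m n} → m < n → (m N.<ᵇ n) ≡ true
<ᵇ-true {m} {n} = dec-true (m N.<? n)

<ᵇ-false : ∀ {m n} → n ≤ m → (m N.<ᵇ n) ≡ false
<ᵇ-false {m} {n} n≤m = dec-false (m N.<? n) (NP.≤⇒≯ n≤m)

signed : ∀ {n} → Bool → Vect n → Vect n
signed true v = v
signed false v = neg v

neg-signed : ∀ {n} b (v : Vect n) → neg (signed b v) ≡ signed (not b) v
neg-signed true v = refl
neg-signed false v = neg-neg v

isPositive : ℤ → Bool
isPositive (+ _) = true
isPositive -[1+ _ ] = false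

signedBasis-≡ : ∀ {n} (x : ℤ) (p : Fin n) → N.suc (toℕ p) ≡ ∣ x ∣ → signedBasis x ≡ signed (isPositive x) (e p)
signedBasis-≡ (+ N.suc _) p refl = vec-ext λ m →
  trans (VP.lookup∘tabulate _ m) (trans (cong (λ b → if b then 1ℤ else 0ℤ) (≡ᵇ-toℕ m p)) (sym (coord-e p m)))
signedBasis-≡ -[1+ _ ] p refl = vec-ext λ m →
  trans (VP.lookup∘tabulate _ m) (trans (cong (λ b → if b then -1ℤ else 0ℤ) (≡ᵇ-toℕ m p))
    (trans (negate-if (does (m F.≟ p))) (sym (trans (coord-neg (e p) m) (cong -_ (coord-e p m))))))
  where
  negate-if : ∀ b → (if b then -1ℤ else 0ℤ) ≡ - (if b then 1ℤ else 0ℤ)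
  negate-if true = refl
  negate-if false = refl

-- Deciding positivity of ±e_p and of ±e_p ± e_q: the sign at the smaller
-- position decides, as the partial sum up to that position shows.
partial-signed-out : ∀ {n} τ j (q : Fin n) → j < toℕ q → partial j (signed τ (e q)) ≡ 0ℤ
partial-signed-out true j q j<q = partial-e-out j q j<q
partial-signed-out false j q j<q = trans (partial-neg j (e q)) (cong -_ (partial-e-out j q j<q))

partial-neg-e : ∀ {n} (p : Fin n) → partial (toℕ p) (neg (e p)) ≡ -1ℤ
partial-neg-e p = trans (partial-neg (toℕ p) (e p)) (cong -_ (partial-e-in (toℕ p) p NP.≤-refl))

isPosRoot-signed : ∀ {n} σ (p : Fin n) → isPosRoot (signed σ (e p)) ≡ σ
isPosRoot-signed true p = isPosRoot-true (inj₂ (p , refl))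
isPosRoot-signed false p = isPosRoot-false (neg (e p)) (toℕ p) (subst (Z._< 0ℤ) (sym (partial-neg-e p)) Z.-<+)

isPosRoot-signed-pair< : ∀ {n} σ τ (p q : Fin n) → toℕ p < toℕ q →
  isPosRoot (signed σ (e p) ⊕ signed τ (e q)) ≡ σ
isPosRoot-signed-pair< true true p q p<q = isPosRoot-true (inj₁ (p , q , p<q , inj₂ refl))
isPosRoot-signed-pair< true false p q p<q = isPosRoot-true (inj₁ (p , q , p<q , inj₁ (sym (⊖≡⊕neg (e p) (e q)))))
isPosRoot-signed-pair< false τ p q p<q = isPosRoot-false (neg (e p) ⊕ signed τ (e q)) (toℕ p)
  (subst (Z._< 0ℤ) (sym at-p) Z.-<+)
  where
  at-p : partial (toℕ p) (neg (e p) ⊕ signed τ (e q)) ≡ -1ℤ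
  at-p = trans (partial-⊕ (toℕ p) (neg (e p)) (signed τ (e q)))
               (cong₂ _+_ (partial-neg-e p) (partial-signed-out τ (toℕ p) q p<q))

isPosRoot-signed-pair : ∀ {n} σ τ (p q : Fin n) → p ≢ q →
  isPosRoot (signed σ (e p) ⊕ signed τ (e q)) ≡ (if toℕ p N.<ᵇ toℕ q then σ else τ)
isPosRoot-signed-pair σ τ p q p≢q with NP.<-cmp (toℕ p) (toℕ q)
... | tri< p<q _ _ rewrite <ᵇ-true p<q = isPosRoot-signed-pair< σ τ p q p<q
... | tri≈ _ p≡q _ = ⊥-elim (p≢q (FP.toℕ-injective p≡q))
... | tri> _ _ q<p rewrite <ᵇ-false (NP.<⇒≤ q<p) =
  trans (cong isPosRoot (⊕-comm (signed σ (e p)) (signed τ (e q)))) (isPosRoot-signed-pair< τ σ q p q<p)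

position : ∀ {n} m → 1 ≤ m → m ≤ n → Σ (Fin n) λ p → N.suc (toℕ p) ≡ m
position (N.suc m) _ m<n = F.fromℕ< m<n , cong N.suc (FP.toℕ-fromℕ< m<n)

module Inversions {n} (w : Vec ℤ n) (sp : SignedPerm n w) where
  open Action w

  size : Fin n → ℕ
  size a = ∣ lookup w a ∣

  pos : Fin n → Bool
  pos a = isPositive (lookup w a)

  target : Fin n → Fin n
  target a = proj₁ (position (size a) (proj₁ (proj₁ sp a)) (proj₂ (proj₁ sp a)))

  target-size : ∀ a → N.suc (toℕ (target a)) ≡ size a
  target-size a = proj₂ (position (size a) (proj₁ (proj₁ sp a)) (proj₂ (proj₁ sp a)))

  size-injective : ∀ a b → size a ≡ size b → a ≡ b
  size-injective = proj₂ sp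

  target-distinct : ∀ a b → toℕ a < toℕ b → target a ≢ target b
  target-distinct a b a<b ta≡tb = NP.<-irrefl (cong toℕ (size-injective a b sizes≡)) a<b
    where
    sizes≡ : size a ≡ size b
    sizes≡ = trans (sym (target-size a)) (trans (cong (N.suc ∘ toℕ) ta≡tb) (target-size b))

  image-signed : ∀ a → image a ≡ signed (pos a) (e (target a))
  image-signed a = signedBasis-≡ (lookup w a) (target a) (target-size a)

  neg-image : ∀ a → neg (image a) ≡ signed (not (pos a)) (e (target a))
  neg-image a = trans (cong neg (image-signed a)) (neg-signed (pos a) (e (target a)))

  targets-vs-sizes : ∀ a b → (toℕ (target a) N.<ᵇ toℕ (target b)) ≡ (size a N.<ᵇ size b)
  targets-vs-sizes a b = cong₂ N._<ᵇ_ (target-size a) (target-size b)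

  inversion-of-root : ∀ {α} → PositiveRoot α → lam w α ≡ isPosRoot (neg (act w α))
  inversion-of-root pr rewrite isPosRoot-true pr = refl

  lam-e : ∀ a → lam w (e a) ≡ not (pos a)
  lam-e a = begin
    lam w (e a)                                     ≡⟨ inversion-of-root (inj₂ (a , refl)) ⟩
    isPosRoot (neg (act w (e a)))                   ≡⟨ cong (isPosRoot ∘ neg) (act-e a) ⟩
    isPosRoot (neg (image a))                       ≡⟨ cong isPosRoot (neg-image a) ⟩
    isPosRoot (signed (not (pos a)) (e (target a))) ≡⟨ isPosRoot-signed (not (pos a)) (target a) ⟩
    not (pos a)                                     ∎
    where open ≡-Reasoning

  lam-⊖ : ∀ a b → toℕ a < toℕ b →
    lam w (e a ⊖ e b) ≡ (if size a N.<ᵇ size b then not (pos a) else pos b)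
  lam-⊖ a b a<b = begin
    lam w (e a ⊖ e b)                                   ≡⟨ inversion-of-root (inj₁ (a , b , a<b , inj₁ refl)) ⟩
    isPosRoot (neg (act w (e a ⊖ e b)))                 ≡⟨ cong (isPosRoot ∘ neg) (trans (act-⊖ (e a) (e b)) (cong₂ _⊖_ (act-e a) (act-e b))) ⟩
    isPosRoot (neg (image a ⊖ image b))                 ≡⟨ cong isPosRoot (trans (neg-⊖ (image a) (image b)) (cong₂ _⊕_ (neg-image a) (image-signed b))) ⟩
    isPosRoot (signed (not (pos a)) (e (target a)) ⊕ signed (pos b) (e (target b)))
                                                        ≡⟨ isPosRoot-signed-pair _ _ (target a) (target b) (target-distinct a b a<b) ⟩
    (if toℕ (target a) N.<ᵇ toℕ (target b) then not (pos a) else pos b)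
                                                        ≡⟨ cong (if_then not (pos a) else pos b) (targets-vs-sizes a b) ⟩
    (if size a N.<ᵇ size b then not (pos a) else pos b) ∎
    where open ≡-Reasoning

  lam-⊕ : ∀ a b → toℕ a < toℕ b →
    lam w (e a ⊕ e b) ≡ (if size a N.<ᵇ size b then not (pos a) else not (pos b))
  lam-⊕ a b a<b = begin
    lam w (e a ⊕ e b)                                   ≡⟨ inversion-of-root (inj₁ (a , b , a<b , inj₂ refl)) ⟩
    isPosRoot (neg (act w (e a ⊕ e b)))                 ≡⟨ cong (isPosRoot ∘ neg) (trans (act-⊕ (e a) (e b)) (cong₂ _⊕_ (act-e a) (act-e b))) ⟩
    isPosRoot (neg (image a ⊕ image b))                 ≡⟨ cong isPosRoot (trans (neg-⊕ (image a) (image b)) (cong₂ _⊕_ (neg-image a) (neg-image b))) ⟩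
    isPosRoot (signed (not (pos a)) (e (target a)) ⊕ signed (not (pos b)) (e (target b)))
                                                        ≡⟨ isPosRoot-signed-pair _ _ (target a) (target b) (target-distinct a b a<b) ⟩
    (if toℕ (target a) N.<ᵇ toℕ (target b) then not (pos a) else not (pos b))
                                                        ≡⟨ cong (if_then not (pos a) else not (pos b)) (targets-vs-sizes a b) ⟩
    (if size a N.<ᵇ size b then not (pos a) else not (pos b)) ∎
    where open ≡-Reasoning

witness : ∀ {P : Set} (d : Dec P) → does d ≡ true → P
witness (yes p) _ = p

refute-≤ : ∀ {x y x' y' : ℤ} → x ≡ x' → y ≡ y' → y' Z.< x' → ¬ (x Z.≤ y)
refute-≤ refl refl y<x x≤y = ZP.≤⇒≯ x≤y y<x

0<1 : 0ℤ Z.< 1ℤ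
0<1 = Z.+<+ (N.s≤s N.z≤n)

1<2 : 1ℤ Z.< + 2
1<2 = Z.+<+ (N.s≤s (N.s≤s N.z≤n))

0<2 : 0ℤ Z.< + 2
0<2 = Z.+<+ (N.s≤s N.z≤n)

module _ {n} {j : ℕ} {a : Fin n} (a≤j : toℕ a ≤ j) where

  partial-⊖-in : ∀ c → toℕ c ≤ j → partial j (e a ⊖ e c) ≡ 0ℤ
  partial-⊖-in c c≤j = trans (partial-⊖ j (e a) (e c)) (cong₂ _-_ (partial-e-in j a a≤j) (partial-e-in j c c≤j))

  partial-⊖-out : ∀ c → j < toℕ c → partial j (e a ⊖ e c) ≡ 1ℤ
  partial-⊖-out c j<c = trans (partial-⊖ j (e a) (e c)) (cong₂ _-_ (partial-e-in j a a≤j) (partial-e-out j c j<c))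

  partial-⊕-in : ∀ c → toℕ c ≤ j → partial j (e a ⊕ e c) ≡ + 2
  partial-⊕-in c c≤j = trans (partial-⊕ j (e a) (e c)) (cong₂ _+_ (partial-e-in j a a≤j) (partial-e-in j c c≤j))

  partial-⊕-out : ∀ c → j < toℕ c → partial j (e a ⊕ e c) ≡ 1ℤ
  partial-⊕-out c j<c = trans (partial-⊕ j (e a) (e c)) (cong₂ _+_ (partial-e-in j a a≤j) (partial-e-out j c j<c))

-- In the top region, e_a + e_b ⪯ e_a' + e_b' forces a' ≤ a and b' ≤ b:
-- compare the partial sums up to a and up to b.
top-⪯ : ∀ {n} {a b a' b' : Fin n} → toℕ a < toℕ b → toℕ a' < toℕ b' →
  (e a ⊕ e b) ⪯ (e a' ⊕ e b') → toℕ a' ≤ toℕ a × toℕ b' ≤ toℕ b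
top-⪯ {a = a} {b} {a'} {b'} a<b a'<b' α⪯β = a'≤a , b'≤b
  where
  a'≤a : toℕ a' ≤ toℕ a
  a'≤a with toℕ a' N.≤? toℕ a
  ... | yes a'≤a = a'≤a
  ... | no a'≰a = ⊥-elim (refute-≤ (partial-⊕-out NP.≤-refl b a<b) β-at-a 0<1 (⪯-partial α⪯β (toℕ a)))
    where
    a<a' = NP.≰⇒> a'≰a
    β-at-a : partial (toℕ a) (e a' ⊕ e b') ≡ 0ℤ
    β-at-a = trans (partial-⊕ (toℕ a) (e a') (e b'))
                   (cong₂ _+_ (partial-e-out _ a' a<a') (partial-e-out _ b' (NP.<-trans a<a' a'<b')))
  b'≤b : toℕ b' ≤ toℕ b
  b'≤b with toℕ b' N.≤? toℕ b
  ... | yes b'≤b = b'≤b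
  ... | no b'≰b = ⊥-elim (refute-≤ (partial-⊕-in (NP.<⇒≤ a<b) b NP.≤-refl)
                                   (partial-⊕-out (NP.≤-trans a'≤a (NP.<⇒≤ a<b)) b' (NP.≰⇒> b'≰b)) 1<2
                                   (⪯-partial α⪯β (toℕ b)))

rowOf : ∀ {n k} {α : Vect n} → BaseRegion k α → Fin n
rowOf (inj₁ (a , _)) = a
rowOf (inj₂ (a , _)) = a

rowOf<k : ∀ {n k} {α : Vect n} (h : BaseRegion k α) → toℕ (rowOf h) < k
rowOf<k (inj₁ (_ , _ , a<k , _)) = a<k
rowOf<k (inj₂ (_ , a<k , _)) = a<k

base-partial-left : ∀ {n k} {α : Vect n} (h : BaseRegion k α) j → j < k → partial j α ≡ partial j (e (rowOf h))
base-partial-left (inj₂ (a , _ , refl)) j j<k = refl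
base-partial-left (inj₁ (a , c , _ , k≤c , inj₁ refl)) j j<k =
  trans (partial-⊖ j (e a) (e c))
        (trans (cong (_-_ (partial j (e a))) (partial-e-out j c (NP.<-≤-trans j<k k≤c))) (ZP.+-identityʳ _))
base-partial-left (inj₁ (a , c , _ , k≤c , inj₂ refl)) j j<k =
  trans (partial-⊕ j (e a) (e c))
        (trans (cong (_+_ (partial j (e a))) (partial-e-out j c (NP.<-≤-trans j<k k≤c))) (ZP.+-identityʳ _))

base-rows : ∀ {n k} {α β : Vect n} (hα : BaseRegion k α) (hβ : BaseRegion k β) →
  α ⪯ β → toℕ (rowOf hβ) ≤ toℕ (rowOf hα)
base-rows hα hβ α⪯β with toℕ (rowOf hβ) N.≤? toℕ (rowOf hα)
... | yes β-row≤α-row = β-row≤α-row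
... | no β-row≰α-row = ⊥-elim (refute-≤
      (trans (base-partial-left hα j (rowOf<k hα)) (partial-e-in j (rowOf hα) NP.≤-refl))
      (trans (base-partial-left hβ j (rowOf<k hα)) (partial-e-out j (rowOf hβ) (NP.≰⇒> β-row≰α-row)))
      0<1 (⪯-partial α⪯β j))
  where j = toℕ (rowOf hα)

-- Comparing partial sums up to a column c' ≥ k: below e_a' - e_c' in the base
-- region lie only roots e_a - e_c with c ≤ c' (all others have partial sum ≥ 1
-- there, e_a' - e_c' has 0).
module _ {n k} {a' c' : Fin n} (a'<k : toℕ a' < k) (k≤c' : k ≤ toℕ c') where

  private
    left-of-c' : ∀ {a : Fin n} → toℕ a < k → toℕ a ≤ toℕ c'
    left-of-c' a<k = NP.<⇒≤ (NP.<-≤-trans a<k k≤c')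

    β-at-c' : partial (toℕ c') (e a' ⊖ e c') ≡ 0ℤ
    β-at-c' = partial-⊖-in (left-of-c' a'<k) c' NP.≤-refl

  below-⊖ : ∀ {α : Vect n} (hα : BaseRegion k α) → α ⪯ (e a' ⊖ e c') →
    ∃[ c ] (k ≤ toℕ c × toℕ c ≤ toℕ c' × α ≡ e (rowOf hα) ⊖ e c)
  below-⊖ (inj₂ (a , a<k , refl)) α⪯β =
    ⊥-elim (refute-≤ (partial-e-in _ a (left-of-c' a<k)) β-at-c' 0<1 (⪯-partial α⪯β (toℕ c')))
  below-⊖ (inj₁ (a , c , a<k , _ , inj₂ refl)) α⪯β with toℕ c N.≤? toℕ c'
  ... | yes c≤c' = ⊥-elim (refute-≤ (partial-⊕-in (left-of-c' a<k) c c≤c') β-at-c' 0<2 (⪯-partial α⪯β (toℕ c')))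
  ... | no c≰c' = ⊥-elim (refute-≤ (partial-⊕-out (left-of-c' a<k) c (NP.≰⇒> c≰c')) β-at-c' 0<1 (⪯-partial α⪯β (toℕ c')))
  below-⊖ (inj₁ (a , c , a<k , k≤c , inj₁ refl)) α⪯β with toℕ c N.≤? toℕ c'
  ... | yes c≤c' = c , k≤c , c≤c' , refl
  ... | no c≰c' = ⊥-elim (refute-≤ (partial-⊖-out (left-of-c' a<k) c (NP.≰⇒> c≰c')) β-at-c' 0<1 (⪯-partial α⪯β (toℕ c')))

-- Dually, above e_a + e_c in the base region lie only roots e_a' + e_c' with
-- c' ≤ c (all others have partial sum ≤ 1 up to c, e_a + e_c has 2).
module _ {n k} {a c : Fin n} (a<k : toℕ a < k) (k≤c : k ≤ toℕ c) where

  private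
    left-of-c : ∀ {a' : Fin n} → toℕ a' < k → toℕ a' ≤ toℕ c
    left-of-c a'<k = NP.<⇒≤ (NP.<-≤-trans a'<k k≤c)

    α-at-c : partial (toℕ c) (e a ⊕ e c) ≡ + 2
    α-at-c = partial-⊕-in (left-of-c a<k) c NP.≤-refl

  above-⊕ : ∀ {β : Vect n} (hβ : BaseRegion k β) → (e a ⊕ e c) ⪯ β →
    ∃[ c' ] (k ≤ toℕ c' × toℕ c' ≤ toℕ c × β ≡ e (rowOf hβ) ⊕ e c')
  above-⊕ (inj₂ (a' , a'<k , refl)) α⪯β =
    ⊥-elim (refute-≤ α-at-c (partial-e-in _ a' (left-of-c a'<k)) 1<2 (⪯-partial α⪯β (toℕ c)))
  above-⊕ (inj₁ (a' , c' , a'<k , _ , inj₁ refl)) α⪯β with toℕ c' N.≤? toℕ c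
  ... | yes c'≤c = ⊥-elim (refute-≤ α-at-c (partial-⊖-in (left-of-c a'<k) c' c'≤c) 0<2 (⪯-partial α⪯β (toℕ c)))
  ... | no c'≰c = ⊥-elim (refute-≤ α-at-c (partial-⊖-out (left-of-c a'<k) c' (NP.≰⇒> c'≰c)) 1<2 (⪯-partial α⪯β (toℕ c)))
  above-⊕ (inj₁ (a' , c' , a'<k , k≤c' , inj₂ refl)) α⪯β with toℕ c' N.≤? toℕ c
  ... | yes c'≤c = c' , k≤c' , c'≤c , refl
  ... | no c'≰c = ⊥-elim (refute-≤ α-at-c (partial-⊕-out (left-of-c a'<k) c' (NP.≰⇒> c'≰c)) 1<2 (⪯-partial α⪯β (toℕ c)))

χ : Bool → ℕ
χ true = 1
χ false = 0

χ-≤1 : ∀ b → χ b ≤ 1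
χ-≤1 true = NP.≤-refl
χ-≤1 false = N.z≤n

count : ∀ {n} → Subset n → List (Vect n) → ℕ
count S xs = L.length (L.filterᵇ S xs)

count-∷ : ∀ {n} (S : Subset n) u xs → count S (u ∷ xs) ≡ χ (S u) N.+ count S xs
count-∷ S u xs with S u
... | true = refl
... | false = refl

count-++ : ∀ {n} (S : Subset n) xs ys → count S (xs ++ ys) ≡ count S xs N.+ count S ys
count-++ S xs ys = trans (cong L.length (LP.filter-++ (T? ∘ S) xs ys)) (LP.length-++ (L.filterᵇ S xs))

count-concatMap : ∀ {n m k} (S : Subset n) (f : Fin m → List (Vect n)) (g : Fin k → Fin m) →
  count S (L.concatMap f (L.tabulate g)) ≡ Σℕ.sum (λ i → count S (f (g i)))
count-concatMap {k = N.zero} S f g = refl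
count-concatMap {k = N.suc k} S f g =
  trans (count-++ S (f (g zero)) _) (cong (count S (f (g zero)) N.+_) (count-concatMap S f (g ∘ suc)))

count-if : ∀ {n} {P : Set} (S : Subset n) (d : Dec P) xs → P → count S (if does d then xs else []) ≡ count S xs
count-if S (yes _) xs _ = refl
count-if S (no ¬p) xs p = ⊥-elim (¬p p)

count-if-not : ∀ {n} {P : Set} (S : Subset n) (d : Dec P) xs → ¬ P → count S (if does d then xs else []) ≡ 0
count-if-not S (yes p) xs ¬p = ⊥-elim (¬p p)
count-if-not S (no _) xs _ = refl

sum-≤ : ∀ {n} k m (f : Fin n → ℕ) → (∀ i → toℕ i < k → f i ≡ 0) → (∀ i → k ≤ toℕ i → f i ≤ m) →
  Σℕ.sum f ≤ m N.* (n N.∸ k)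
sum-≤ {N.zero} k m f _ _ = N.z≤n
sum-≤ {N.suc n} N.zero m f _ bound rewrite NP.*-suc m n =
  NP.+-mono-≤ (bound zero N.z≤n) (sum-≤ 0 m (f ∘ suc) (λ _ ()) (λ i _ → bound (suc i) N.z≤n))
sum-≤ {N.suc n} (N.suc k) m f vanish bound rewrite vanish zero (N.s≤s N.z≤n) =
  sum-≤ k m (f ∘ suc) (λ i i<k → vanish (suc i) (N.s≤s i<k)) (λ i k≤i → bound (suc i) (N.s≤s k≤i))

sum-≥ : ∀ {n} k m (f : Fin n → ℕ) → (∀ i → k ≤ toℕ i → m ≤ f i) → m N.* (n N.∸ k) ≤ Σℕ.sum f
sum-≥ {N.zero} k m f _ rewrite NP.0∸n≡0 k | NP.*-zeroʳ m = N.z≤n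
sum-≥ {N.suc n} N.zero m f bound rewrite NP.*-suc m n =
  NP.+-mono-≤ (bound zero N.z≤n) (sum-≥ 0 m (f ∘ suc) (λ i _ → bound (suc i) N.z≤n))
sum-≥ {N.suc n} (N.suc k) m f bound =
  NP.≤-trans (sum-≥ k m (f ∘ suc) (λ i k≤i → bound (suc i) (N.s≤s k≤i))) (NP.m≤n+m _ (f zero))

at-most-one : ∀ {x y} z → x < y → χ (does (z N.≤? x)) N.+ χ (does (y N.<? z)) ≤ 1
at-most-one {x} {y} z x<y = cases (z N.≤? x) (y N.<? z)
  where
  cases : (d : Dec (z ≤ x)) (d' : Dec (y < z)) → χ (does d) N.+ χ (does d') ≤ 1
  cases (yes z≤x) (yes y<z) = ⊥-elim (NP.<-asym (NP.≤-<-trans z≤x x<y) y<z)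
  cases (yes _) (no _) = NP.≤-refl
  cases (no _) (yes _) = NP.≤-refl
  cases (no _) (no _) = N.z≤n

at-least-one : ∀ {x y} z → y ≤ x → 1 ≤ χ (does (z N.≤? x)) N.+ χ (does (y N.<? z))
at-least-one {x} {y} z y≤x = cases (z N.≤? x) (y N.<? z)
  where
  cases : (d : Dec (z ≤ x)) (d' : Dec (y < z)) → 1 ≤ χ (does d) N.+ χ (does d')
  cases (yes _) _ = N.s≤s N.z≤n
  cases (no _) (yes _) = N.s≤s N.z≤n
  cases (no z≰x) (no y≮z) = ⊥-elim (y≮z (NP.≤-<-trans y≤x (NP.≰⇒> z≰x)))

-- The condition of Θ on one pair: t is the threshold, s the row count and b
-- the membership of e_a + e_b.  It holds once b agrees with a weak comparison.
Balanced : ℕ → ℕ → Bool → Set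
Balanced t s b = (t < s → b ≡ true) × (s < t → b ≡ false)

balanced-in : ∀ {t s b} → b ≡ true → t ≤ s → Balanced t s b
balanced-in b≡true t≤s = (λ _ → b≡true) , (λ s<t → ⊥-elim (NP.<⇒≱ s<t t≤s))

balanced-out : ∀ {t s b} → b ≡ false → s ≤ t → Balanced t s b
balanced-out b≡false s≤t = (λ t<s → ⊥-elim (NP.<⇒≱ t<s s≤t)) , (λ _ → b≡false)

threshold : ∀ {n k} → k ≤ n → (2 N.* n N.+ 1) N.∸ 2 N.* k ≡ 2 N.* (n N.∸ k) N.+ 1
threshold {n} {k} k≤n = trans (NP.+-∸-comm 1 (NP.*-monoʳ-≤ 2 k≤n)) (cong (N._+ 1) (sym (NP.*-distribˡ-∸ 2 n k)))

isPositive-pos : ∀ {x} → 0ℤ Z.< x → isPositive x ≡ true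
isPositive-pos {+ _} _ = refl

isPositive-neg : ∀ {x} → x Z.< 0ℤ → isPositive x ≡ false
isPositive-neg { -[1+ _ ]} _ = refl
isPositive-neg {+ _} (Z.+<+ ())

∣∣-mono-< : ∀ {x y} → 0ℤ Z.< x → x Z.< y → ∣ x ∣ < ∣ y ∣
∣∣-mono-< {+ _} {+ _} _ (Z.+<+ x<y) = x<y

excluded : ∀ {b} → b ≡ false → b ≢ true
excluded refl ()

if-same : ∀ b (x : Bool) → (if b then x else x) ≡ x
if-same true x = refl
if-same false x = refl

if-id : ∀ b → (if b then true else false) ≡ b
if-id true = refl
if-id false = refl

fails-<ᵇ : ∀ m n → (if m N.<ᵇ n then false else true) ≡ does (n N.≤? m)
fails-<ᵇ m n with m N.<ᵇ n in m<ᵇn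
... | true = sym (dec-false (n N.≤? m) (NP.<⇒≱ (NP.<ᵇ⇒< m n (subst T (sym m<ᵇn) _))))
... | false = sym (dec-true (n N.≤? m) (NP.≮⇒≥ (λ m<n → subst T m<ᵇn (NP.<⇒<ᵇ m<n))))

-- With ℓ = k - r, its positions form three
-- blocks: Y (positions < ℓ) with positive entries of increasing size, Z
-- (ℓ ≤ position < k) with negative entries of decreasing size, and V
-- (positions ≥ k) with positive entries of increasing size.
module Grassmannian {n k : ℕ} {w : Vec ℤ n} (hw : InWOG n k w) where
  open Inversions w (proj₁ hw)

  S : Subset n
  S = lam w

  ℓ : ℕ
  ℓ = k N.∸ proj₁ (proj₂ hw)

  private
    signs = proj₁ (proj₂ (proj₂ (proj₂ hw)))
    orders = proj₂ (proj₂ (proj₂ (proj₂ hw)))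

  Y Z V : Fin n → Set
  Y i = toℕ i < ℓ
  Z i = ℓ ≤ toℕ i × toℕ i < k
  V i = k ≤ toℕ i

  ℓ≤k : ℓ ≤ k
  ℓ≤k = NP.m∸n≤m k (proj₁ (proj₂ hw))

  Y-or-Z : ∀ i → toℕ i < k → Y i ⊎ Z i
  Y-or-Z i i<k with toℕ i N.<? ℓ
  ... | yes i<ℓ = inj₁ i<ℓ
  ... | no i≮ℓ = inj₂ (NP.≮⇒≥ i≮ℓ , i<k)

  pos-Y : ∀ i → Y i → pos i ≡ true
  pos-Y i i<ℓ = isPositive-pos (proj₁ (signs i) i<ℓ)

  pos-Z : ∀ i → Z i → pos i ≡ false
  pos-Z i (ℓ≤i , i<k) = isPositive-neg (proj₁ (proj₂ (signs i)) ℓ≤i i<k)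

  pos-V : ∀ i → V i → pos i ≡ true
  pos-V i k≤i = isPositive-pos (proj₂ (proj₂ (signs i)) k≤i)

  size-Y : ∀ i j → toℕ i < toℕ j → Y j → size i < size j
  size-Y i j i<j j<ℓ = ∣∣-mono-< (proj₁ (signs i) (NP.<-trans i<j j<ℓ)) (proj₁ (orders i j i<j) j<ℓ)

  size-Z : ∀ i j → toℕ i < toℕ j → Z i → toℕ j < k → size j < size i
  size-Z i j i<j (ℓ≤i , _) j<k = proj₁ (proj₂ (orders i j i<j)) ℓ≤i j<k

  size-V : ∀ i j → toℕ i < toℕ j → V i → size i < size j
  size-V i j i<j k≤i = ∣∣-mono-< (proj₂ (proj₂ (signs i)) k≤i) (proj₂ (proj₂ (orders i j i<j)) k≤i)

  equal-or-< : ∀ (i j : Fin n) → toℕ i ≤ toℕ j → i ≡ j ⊎ toℕ i < toℕ j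
  equal-or-< i j i≤j with NP.m≤n⇒m<n∨m≡n i≤j
  ... | inj₁ i<j = inj₂ i<j
  ... | inj₂ i≡j = inj₁ (FP.toℕ-injective i≡j)

  size-Y≤ : ∀ i j → toℕ i ≤ toℕ j → Y j → size i ≤ size j
  size-Y≤ i j i≤j j∈Y with equal-or-< i j i≤j
  ... | inj₁ refl = NP.≤-refl
  ... | inj₂ i<j = NP.<⇒≤ (size-Y i j i<j j∈Y)

  size-Z≤ : ∀ i j → toℕ i ≤ toℕ j → Z i → toℕ j < k → size j ≤ size i
  size-Z≤ i j i≤j i∈Z j<k with equal-or-< i j i≤j
  ... | inj₁ refl = NP.≤-refl
  ... | inj₂ i<j = NP.<⇒≤ (size-Z i j i<j i∈Z j<k)

  size-V≤ : ∀ i j → toℕ i ≤ toℕ j → V i → size i ≤ size j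
  size-V≤ i j i≤j i∈V with equal-or-< i j i≤j
  ... | inj₁ refl = NP.≤-refl
  ... | inj₂ i<j = NP.<⇒≤ (size-V i j i<j i∈V)

  Y<k : ∀ {i : Fin n} → Y i → toℕ i < k
  Y<k i<ℓ = NP.<-≤-trans i<ℓ ℓ≤k

  <V : ∀ {i c : Fin n} → toℕ i < k → V c → toℕ i < toℕ c
  <V i<k k≤c = NP.<-≤-trans i<k k≤c

  e-Y : ∀ a → Y a → S (e a) ≡ false
  e-Y a a∈Y rewrite lam-e a | pos-Y a a∈Y = refl

  e-Z : ∀ a → Z a → S (e a) ≡ true
  e-Z a a∈Z rewrite lam-e a | pos-Z a a∈Z = refl

  e-V : ∀ a → V a → S (e a) ≡ false
  e-V a a∈V rewrite lam-e a | pos-V a a∈V = refl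

  ⊕-pos-pos : ∀ a c → toℕ a < toℕ c → pos a ≡ true → pos c ≡ true → S (e a ⊕ e c) ≡ false
  ⊕-pos-pos a c a<c pa pc rewrite lam-⊕ a c a<c | pa | pc = if-same _ false

  ⊕-neg-neg : ∀ a c → toℕ a < toℕ c → pos a ≡ false → pos c ≡ false → S (e a ⊕ e c) ≡ true
  ⊕-neg-neg a c a<c pa pc rewrite lam-⊕ a c a<c | pa | pc = if-same _ true

  ⊕-Y-Z : ∀ a c → Y a → Z c → S (e a ⊕ e c) ≡ does (size c N.≤? size a)
  ⊕-Y-Z a c a∈Y c∈Z rewrite lam-⊕ a c (NP.<-≤-trans a∈Y (proj₁ c∈Z)) | pos-Y a a∈Y | pos-Z c c∈Z =
    fails-<ᵇ (size a) (size c)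

  ⊕-Z-V : ∀ a c → Z a → V c → S (e a ⊕ e c) ≡ does (size a N.<? size c)
  ⊕-Z-V a c a∈Z c∈V rewrite lam-⊕ a c (<V (proj₂ a∈Z) c∈V) | pos-Z a a∈Z | pos-V c c∈V =
    if-id (size a N.<ᵇ size c)

  ⊖-smaller-pos : ∀ a c → toℕ a < toℕ c → pos a ≡ true → size a < size c → S (e a ⊖ e c) ≡ false
  ⊖-smaller-pos a c a<c pa sa<sc rewrite lam-⊖ a c a<c | <ᵇ-true sa<sc | pa = refl

  ⊖-Y-V : ∀ a c → Y a → V c → S (e a ⊖ e c) ≡ does (size c N.≤? size a)
  ⊖-Y-V a c a∈Y c∈V rewrite lam-⊖ a c (<V (Y<k a∈Y) c∈V) | pos-Y a a∈Y | pos-V c c∈V =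
    fails-<ᵇ (size a) (size c)

  ⊖-Z-V : ∀ a c → Z a → V c → S (e a ⊖ e c) ≡ true
  ⊖-Z-V a c a∈Z c∈V rewrite lam-⊖ a c (<V (proj₂ a∈Z) c∈V) | pos-Z a a∈Z | pos-V c c∈V = if-same _ true

  ⊖-top : ∀ a b → toℕ a < toℕ b → toℕ b < k → S (e a ⊖ e b) ≡ false
  ⊖-top a b a<b b<k with Y-or-Z b b<k | Y-or-Z a (NP.<-trans a<b b<k)
  ... | inj₁ b∈Y | _ = ⊖-smaller-pos a b a<b (pos-Y a (NP.<-trans a<b b∈Y)) (size-Y a b a<b b∈Y)
  ... | inj₂ b∈Z | inj₁ a∈Y rewrite lam-⊖ a b a<b | pos-Y a a∈Y | pos-Z b b∈Z = if-same _ false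
  ... | inj₂ b∈Z | inj₂ a∈Z rewrite lam-⊖ a b a<b | <ᵇ-false (NP.<⇒≤ (size-Z a b a<b a∈Z b<k)) = pos-Z b b∈Z

  S-positive : ∀ α → S α ≡ true → PositiveRoot α
  S-positive α α∈S with isPosRoot α in isPos
  ... | true = isPosRoot-sound {v = α} isPos

  -- λ(w) ⊆ Λ_k: no inversion has its first position in V, and no e_a - e_b with
  -- both positions left of k is an inversion.
  S⊆Λ : ∀ α → S α ≡ true → Lambda k α
  S⊆Λ α α∈S with S-positive α α∈S
  ... | inj₂ (a , refl) with toℕ a N.<? k
  ...   | yes a<k = inj₁ (inj₂ (a , a<k , refl))
  ...   | no a≮k = ⊥-elim (excluded (e-V a (NP.≮⇒≥ a≮k)) α∈S)
  S⊆Λ α α∈S | inj₁ (a , b , a<b , inj₁ refl) with toℕ a N.<? k | toℕ b N.<? k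
  ... | no a≮k | _ = ⊥-elim (excluded (⊖-smaller-pos a b a<b (pos-V a a∈V) (size-V a b a<b a∈V)) α∈S)
    where a∈V = NP.≮⇒≥ a≮k
  ... | yes _ | yes b<k = ⊥-elim (excluded (⊖-top a b a<b b<k) α∈S)
  ... | yes a<k | no b≮k = inj₁ (inj₁ (a , b , a<k , NP.≮⇒≥ b≮k , inj₁ refl))
  S⊆Λ α α∈S | inj₁ (a , b , a<b , inj₂ refl) with toℕ a N.<? k | toℕ b N.<? k
  ... | no a≮k | _ = ⊥-elim (excluded (⊕-pos-pos a b a<b (pos-V a a∈V) (pos-V b (NP.≤-trans a∈V (NP.<⇒≤ a<b)))) α∈S)
    where a∈V = NP.≮⇒≥ a≮k
  ... | yes _ | yes b<k = inj₂ (a , b , a<b , b<k , refl)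
  ... | yes a<k | no b≮k = inj₁ (inj₁ (a , b , a<k , NP.≮⇒≥ b≮k , inj₂ refl))

  -- S ∩ (top region) is a lower ideal.  If e_a' + e_b' ∈ S lies above e_a + e_b,
  -- then b' ∈ Z, so b ∈ Z; for a ∈ Y also a' ∈ Y and the sizes compare as
  -- |w_b| ≤ |w_b'| ≤ |w_a'| ≤ |w_a|.
  top-ideal : LowerIdealIn (TopRegion k) S
  top-ideal _ _ (a , b , a<b , b<k , refl) (a' , b' , a'<b' , b'<k , refl) β∈S α⪯β
    with top-⪯ a<b a'<b' α⪯β
  ... | a'≤a , b'≤b = by-blocks (Y-or-Z b' b'<k) (Y-or-Z a (NP.<-trans a<b b<k))
    where
    by-blocks : Y b' ⊎ Z b' → Y a ⊎ Z a → S (e a ⊕ e b) ≡ true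
    by-blocks (inj₁ b'∈Y) _ =
      ⊥-elim (excluded (⊕-pos-pos a' b' a'<b' (pos-Y a' (NP.<-trans a'<b' b'∈Y)) (pos-Y b' b'∈Y)) β∈S)
    by-blocks (inj₂ b'∈Z) (inj₂ a∈Z) = ⊕-neg-neg a b a<b (pos-Z a a∈Z) (pos-Z b (NP.≤-trans (proj₁ b'∈Z) b'≤b , b<k))
    by-blocks (inj₂ b'∈Z) (inj₁ a∈Y) = trans (⊕-Y-Z a b a∈Y b∈Z) (dec-true (size b N.≤? size a) sb≤sa)
      where
      b∈Z : Z b
      b∈Z = NP.≤-trans (proj₁ b'∈Z) b'≤b , b<k
      a'∈Y : Y a'
      a'∈Y = NP.≤-<-trans a'≤a a∈Y
      sb'≤sa' : size b' ≤ size a'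
      sb'≤sa' = witness (size b' N.≤? size a') (trans (sym (⊕-Y-Z a' b' a'∈Y b'∈Z)) β∈S)
      sb≤sa : size b ≤ size a
      sb≤sa = NP.≤-trans (size-Z≤ b' b b'≤b b'∈Z b<k) (NP.≤-trans sb'≤sa' (size-Y≤ a' a a'≤a a∈Y))

  -- S ∩ (base region) is a lower ideal, when β ∈ S lies in a row of Y: then
  -- β = e_a' - e_c' with |w_c'| ≤ |w_a'|, and α = e_a - e_c with c ≤ c' and a' ≤ a.
  base-ideal-Y : ∀ {α β} (hα : BaseRegion k α) (hβ : BaseRegion k β) → S β ≡ true → α ⪯ β →
    Y (rowOf hβ) → S α ≡ true
  base-ideal-Y hα (inj₂ (a' , _ , refl)) β∈S α⪯β a'∈Y = ⊥-elim (excluded (e-Y a' a'∈Y) β∈S)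
  base-ideal-Y hα (inj₁ (a' , c' , a'<k , k≤c' , inj₂ refl)) β∈S α⪯β a'∈Y =
    ⊥-elim (excluded (⊕-pos-pos a' c' (<V a'<k k≤c') (pos-Y a' a'∈Y) (pos-V c' k≤c')) β∈S)
  base-ideal-Y hα hβ@(inj₁ (a' , c' , a'<k , k≤c' , inj₁ refl)) β∈S α⪯β a'∈Y
    with below-⊖ a'<k k≤c' hα α⪯β
  ... | c , k≤c , c≤c' , α≡ = subst (λ v → S v ≡ true) (sym α≡) (by-block (Y-or-Z a (rowOf<k hα)))
    where
    a = rowOf hα
    by-block : Y a ⊎ Z a → S (e a ⊖ e c) ≡ true
    by-block (inj₂ a∈Z) = ⊖-Z-V a c a∈Z k≤c
    by-block (inj₁ a∈Y) = trans (⊖-Y-V a c a∈Y k≤c) (dec-true (size c N.≤? size a) sc≤sa)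
      where
      sc'≤sa' : size c' ≤ size a'
      sc'≤sa' = witness (size c' N.≤? size a') (trans (sym (⊖-Y-V a' c' a'∈Y k≤c')) β∈S)
      sc≤sa : size c ≤ size a
      sc≤sa = NP.≤-trans (size-V≤ c c' c≤c' k≤c) (NP.≤-trans sc'≤sa' (size-Y≤ a' a (base-rows hα hβ α⪯β) a∈Y))

  -- The same when β lies in a row of Z: then α lies in a row a of Z as well, and
  -- only α = e_a + e_c needs an argument: β = e_a' + e_c' with c' ≤ c and
  -- |w_a| ≤ |w_a'| < |w_c'| ≤ |w_c|.
  base-ideal-Z : ∀ {α β} (hα : BaseRegion k α) (hβ : BaseRegion k β) → S β ≡ true → α ⪯ β →
    Z (rowOf hβ) → S α ≡ true
  base-ideal-Z hα hβ β∈S α⪯β (ℓ≤a' , _) with hα | base-rows hα hβ α⪯β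
  ... | inj₂ (a , a<k , refl) | a'≤a = e-Z a (NP.≤-trans ℓ≤a' a'≤a , a<k)
  ... | inj₁ (a , c , a<k , k≤c , inj₁ refl) | a'≤a = ⊖-Z-V a c (NP.≤-trans ℓ≤a' a'≤a , a<k) k≤c
  ... | inj₁ (a , c , a<k , k≤c , inj₂ refl) | a'≤a with above-⊕ a<k k≤c hβ α⪯β
  ...   | c' , k≤c' , c'≤c , β≡ = trans (⊕-Z-V a c a∈Z k≤c) (dec-true (size a N.<? size c) sa<sc)
    where
    a' = rowOf hβ
    a∈Z : Z a
    a∈Z = NP.≤-trans ℓ≤a' a'≤a , a<k
    sa'<sc' : size a' < size c'
    sa'<sc' = witness (size a' N.<? size c')
                (trans (sym (⊕-Z-V a' c' (ℓ≤a' , rowOf<k hβ) k≤c')) (subst (λ v → S v ≡ true) β≡ β∈S))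
    sa<sc : size a < size c
    sa<sc = NP.≤-<-trans (size-Z≤ a' a a'≤a (ℓ≤a' , rowOf<k hβ) a<k) (NP.<-≤-trans sa'<sc' (size-V≤ c' c c'≤c k≤c'))

  base-ideal : LowerIdealIn (BaseRegion k) S
  base-ideal α β hα hβ β∈S α⪯β with Y-or-Z (rowOf hβ) (rowOf<k hβ)
  ... | inj₁ β-row∈Y = base-ideal-Y hα hβ β∈S α⪯β β-row∈Y
  ... | inj₂ β-row∈Z = base-ideal-Z hα hβ β∈S α⪯β β-row∈Z

  -- Counting S ∩ row(a) column by column: column c contributes the roots
  -- e_a ∓ e_c when c ∈ V and nothing otherwise, and e_a is counted separately.
  cell : Fin n → Fin n → List (Vect n)
  cell a c = if does (k N.≤? toℕ c) then (e a ⊖ e c) ∷ (e a ⊕ e c) ∷ [] else []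

  cells : Fin n → Fin n → ℕ
  cells a c = count S (cell a c)

  rowCount-cells : ∀ a → rowCount k S a ≡ Σℕ.sum (cells a) N.+ χ (S (e a))
  rowCount-cells a = trans (count-++ S (L.concatMap (cell a) (L.allFin n)) (e a ∷ []))
    (cong₂ N._+_ (count-concatMap S (cell a) id) (trans (count-∷ S (e a) []) (NP.+-identityʳ _)))

  rowCount-pair : ∀ a b → rowCount k S a N.+ rowCount k S b
    ≡ Σℕ.sum (λ c → cells a c N.+ cells b c) N.+ (χ (S (e a)) N.+ χ (S (e b)))
  rowCount-pair a b = begin
    rowCount k S a N.+ rowCount k S b
      ≡⟨ cong₂ N._+_ (rowCount-cells a) (rowCount-cells b) ⟩
    (Σℕ.sum (cells a) N.+ χ (S (e a))) N.+ (Σℕ.sum (cells b) N.+ χ (S (e b)))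
      ≡⟨ interchange (Σℕ.sum (cells a)) (χ (S (e a))) (Σℕ.sum (cells b)) (χ (S (e b))) ⟩
    (Σℕ.sum (cells a) N.+ Σℕ.sum (cells b)) N.+ (χ (S (e a)) N.+ χ (S (e b)))
      ≡⟨ cong (N._+ (χ (S (e a)) N.+ χ (S (e b)))) (Σℕ.∑-distrib-+ (cells a) (cells b)) ⟨
    Σℕ.sum (λ c → cells a c N.+ cells b c) N.+ (χ (S (e a)) N.+ χ (S (e b)))  ∎
    where open ≡-Reasoning

  cells-left : ∀ a c → toℕ c < k → cells a c ≡ 0
  cells-left a c c<k = count-if-not S (k N.≤? toℕ c) _ (NP.<⇒≱ c<k)

  cells-V : ∀ a c → V c → cells a c ≡ χ (S (e a ⊖ e c)) N.+ χ (S (e a ⊕ e c))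
  cells-V a c c∈V = trans (count-if S (k N.≤? toℕ c) _ c∈V)
    (trans (count-∷ S (e a ⊖ e c) _) (cong (χ (S (e a ⊖ e c)) N.+_) (trans (count-∷ S (e a ⊕ e c) []) (NP.+-identityʳ _))))

  cells-Y : ∀ a c → Y a → V c → cells a c ≡ χ (does (size c N.≤? size a))
  cells-Y a c a∈Y c∈V rewrite cells-V a c c∈V | ⊖-Y-V a c a∈Y c∈V
                            | ⊕-pos-pos a c (<V (Y<k a∈Y) c∈V) (pos-Y a a∈Y) (pos-V c c∈V) = NP.+-identityʳ _

  cells-Z : ∀ a c → Z a → V c → cells a c ≡ 1 N.+ χ (does (size a N.<? size c))
  cells-Z a c a∈Z c∈V rewrite cells-V a c c∈V | ⊖-Z-V a c a∈Z c∈V | ⊕-Z-V a c a∈Z c∈V = refl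

  pair-cells-YZ : ∀ a b c → Y a → Z b → V c →
    cells a c N.+ cells b c ≡ N.suc (χ (does (size c N.≤? size a)) N.+ χ (does (size b N.<? size c)))
  pair-cells-YZ a b c a∈Y b∈Z c∈V rewrite cells-Y a c a∈Y c∈V | cells-Z b c b∈Z c∈V = NP.+-suc _ _

  columns : Fin n → Fin n → ℕ
  columns a b = Σℕ.sum (λ c → cells a c N.+ cells b c)

  columns-≤ : ∀ a b → (∀ c → V c → cells a c N.+ cells b c ≤ 2) → columns a b ≤ 2 N.* (n N.∸ k)
  columns-≤ a b bound = sum-≤ k 2 _ (λ c c<k → cong₂ N._+_ (cells-left a c c<k) (cells-left b c c<k)) bound

  columns-≥ : ∀ a b → (∀ c → V c → 2 ≤ cells a c N.+ cells b c) → 2 N.* (n N.∸ k) ≤ columns a b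
  columns-≥ a b bound = sum-≥ k 2 _ bound

  -- Rows of Y contribute at most one
  -- root per column and do not contain e_a, rows of Z at least one and contain
  -- e_a; for a ∈ Y and b ∈ Z the comparison of |w_a| and |w_b| decides both the
  -- columns and the membership of e_a + e_b.
  pair-condition : k ≤ n → ∀ a b → toℕ a < toℕ b → toℕ b < k →
    Balanced ((2 N.* n N.+ 1) N.∸ 2 N.* k) (rowCount k S a N.+ rowCount k S b) (S (e a ⊕ e b))
  pair-condition k≤n a b a<b b<k =
    subst₂ (λ t s → Balanced t s (S (e a ⊕ e b))) (sym (threshold k≤n)) (sym (rowCount-pair a b))
      (by-blocks (Y-or-Z a (NP.<-trans a<b b<k)) (Y-or-Z b b<k))
    where
    by-blocks : Y a ⊎ Z a → Y b ⊎ Z b →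
      Balanced (2 N.* (n N.∸ k) N.+ 1) (columns a b N.+ (χ (S (e a)) N.+ χ (S (e b)))) (S (e a ⊕ e b))
    by-blocks (inj₂ (ℓ≤a , _)) (inj₁ b∈Y) = ⊥-elim (NP.<-irrefl refl (NP.≤-<-trans ℓ≤a (NP.<-trans a<b b∈Y)))
    by-blocks (inj₁ a∈Y) (inj₁ b∈Y) rewrite e-Y a a∈Y | e-Y b b∈Y =
      balanced-out (⊕-pos-pos a b a<b (pos-Y a a∈Y) (pos-Y b b∈Y))
        (NP.+-mono-≤ (columns-≤ a b (λ c c∈V → subst (_≤ 2) (sym (cong₂ N._+_ (cells-Y a c a∈Y c∈V) (cells-Y b c b∈Y c∈V)))
                                                  (NP.+-mono-≤ (χ-≤1 (does (size c N.≤? size a))) (χ-≤1 (does (size c N.≤? size b)))))) N.z≤n)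
    by-blocks (inj₂ a∈Z) (inj₂ b∈Z) rewrite e-Z a a∈Z | e-Z b b∈Z =
      balanced-in (⊕-neg-neg a b a<b (pos-Z a a∈Z) (pos-Z b b∈Z))
        (NP.+-mono-≤ (columns-≥ a b (λ c c∈V → subst (2 ≤_) (sym (cong₂ N._+_ (cells-Z a c a∈Z c∈V) (cells-Z b c b∈Z c∈V)))
                                                  (NP.+-mono-≤ (N.s≤s N.z≤n) (N.s≤s N.z≤n)))) (N.s≤s N.z≤n))
    by-blocks (inj₁ a∈Y) (inj₂ b∈Z) rewrite e-Y a a∈Y | e-Z b b∈Z with size b N.≤? size a
    ... | yes sb≤sa = balanced-in (trans (⊕-Y-Z a b a∈Y b∈Z) (dec-true (size b N.≤? size a) sb≤sa))
        (NP.+-mono-≤ (columns-≥ a b (λ c c∈V → subst (2 ≤_) (sym (pair-cells-YZ a b c a∈Y b∈Z c∈V))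
                                                  (N.s≤s (at-least-one (size c) sb≤sa)))) NP.≤-refl)
    ... | no sb≰sa = balanced-out (trans (⊕-Y-Z a b a∈Y b∈Z) (dec-false (size b N.≤? size a) sb≰sa))
        (NP.+-mono-≤ (columns-≤ a b (λ c c∈V → subst (_≤ 2) (sym (pair-cells-YZ a b c a∈Y b∈Z c∈V))
                                                  (N.s≤s (at-most-one (size c) (NP.≰⇒> sb≰sa))))) NP.≤-refl)

lemma3p5 : (n k : ℕ) → 1 ≤ k → k < n →
    (w : Vec ℤ n) → InWOG n k w → InTheta n k (lam w)
lemma3p5 n k _ k<n w hw = S⊆Λ , base-ideal , top-ideal , pair-condition (NP.<⇒≤ k<n)
  where open Grassmannian {w = w} hw
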